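{- Let $\mathcal{C}$ be a finite category of topological type and $A\subseteq\mathrm{Ob}(\mathcal{C})$. The following are equivalent: (1) $A$ is the intersection of an open set with a closed set; (2) $A=\mathrm{open}(A)\cap\mathrm{closed}(A)$, where $\mathrm{open}(A)$ is the smallest open set containing $A$ and $\mathrm{closed}(A)$ the smallest closed set containing $A$; (3) $A$ is cavity-free: whenever $\varphi_1,\varphi_2$ are morphisms with $t\varphi_1=s\varphi_2$ and $s\varphi_1,t\varphi_2\in A$, then $t\varphi_1\in A$; (4) for every $F\in\mathbb{Q}(\mathcal{C})$ the literal zero extension $F_A$ exists.
   Context: A category is finite if it has finitely many morphisms; it is of topological type if the only endomorphism of each object is the identity and any two objects have at most one morphism between them. $s\varphi,t\varphi$ denote source and target. A subset $U$ of objects is open if every morphism whose target lies in $U$ has source in $U$; $Z$ is closed if every morphism whose source lies in $Z$ has target in $Z$. $\mathbb{Q}(\mathcal{C})$ is the category of functors $\mathcal{C}^{\rm op}\to$ (finite-dimensional $\mathbb{Q}$-vector spaces). The literal zero extension $F_A$ exists if the assignment $F_A(X)=F(X)$ for $X\in A$, $F_A(X)=0$ otherwise, $F_A(\varphi)=F(\varphi)$ if $s\varphi,t\varphi\in A$ and $F_A(\varphi)=0$ otherwise, is a functor $\mathcal{C}^{\rm op}\to$ vector spaces. -}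

module Defs where

open import Data.Nat using (ℕ; zero; suc)
open import Data.Fin using (Fin; zero; suc; _≟_)
open import Data.Bool using (Bool; true; false; if_then_else_)
open import Data.Product using (Σ; _×_; ∃; proj₁)
open import Data.Rational using (ℚ; 0ℚ; 1ℚ; _+_; _*_)
open import Relation.Nullary.Decidable using (⌊_⌋)
open import Relation.Binary.PropositionalEquality using (_≡_)
open import Function.Bundles using (_↔_)

record Category : Set₁ where
  field
    Obj  : Set
    Hom  : Obj → Obj → Set
    id   : ∀ {X} → Hom X X
    _∘_  : ∀ {X Y W} → Hom Y W → Hom X Y → Hom X W
    idˡ  : ∀ {X Y} (f : Hom X Y) → (id ∘ f) ≡ f
    idʳ  : ∀ {X Y} (f : Hom X Y) → (f ∘ id) ≡ f
    assoc : ∀ {X Y W V} (h : Hom W V) (g : Hom Y W) (f : Hom X Y) →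
            ((h ∘ g) ∘ f) ≡ (h ∘ (g ∘ f))

open Category public

Mor : Category → Set
Mor C = Σ (Obj C) λ X → Σ (Obj C) λ Y → Hom C X Y

Finite : Category → Set
Finite C = ∃ λ (n : ℕ) → Fin n ↔ Mor C

TopologicalType : Category → Set
TopologicalType C =
  (∀ {X} (f : Hom C X X) → f ≡ id C) ×
  (∀ {X Y} (f g : Hom C X Y) → f ≡ g)

Subset : Category → Set
Subset C = Obj C → Bool

_∈_ : ∀ {C : Category} → Obj C → Subset C → Set
X ∈ A = A X ≡ true

IsOpen : (C : Category) → Subset C → Set
IsOpen C U = ∀ {X Y} (φ : Hom C X Y) → _∈_ {C} Y U → _∈_ {C} X U

IsClosed : (C : Category) → Subset C → Set
IsClosed C Z = ∀ {X Y} (φ : Hom C X Y) → _∈_ {C} X Z → _∈_ {C} Y Z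

InOpenHull : (C : Category) → Subset C → Obj C → Set
InOpenHull C A X =
  (U : Subset C) → IsOpen C U → (∀ Y → _∈_ {C} Y A → _∈_ {C} Y U) → _∈_ {C} X U

InClosedHull : (C : Category) → Subset C → Obj C → Set
InClosedHull C A X =
  (Z : Subset C) → IsClosed C Z → (∀ Y → _∈_ {C} Y A → _∈_ {C} Y Z) → _∈_ {C} X Z

IsLocallyClosed : (C : Category) → Subset C → Set
IsLocallyClosed C A =
  Σ (Subset C) λ U → Σ (Subset C) λ Z → IsOpen C U × IsClosed C Z ×
    (∀ X → (_∈_ {C} X A → (_∈_ {C} X U × _∈_ {C} X Z)) ×
           ((_∈_ {C} X U × _∈_ {C} X Z) → _∈_ {C} X A))

EqualsHullIntersection : (C : Category) → Subset C → Set
EqualsHullIntersection C A =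
  ∀ X → (_∈_ {C} X A → (InOpenHull C A X × InClosedHull C A X)) ×
        ((InOpenHull C A X × InClosedHull C A X) → _∈_ {C} X A)

CavityFree : (C : Category) → Subset C → Set
CavityFree C A = ∀ {X Y W} (φ₁ : Hom C X Y) (φ₂ : Hom C Y W) →
  _∈_ {C} X A → _∈_ {C} W A → _∈_ {C} Y A

-- Finite-dimensional ℚ-vector spaces: ℚ^m, linear maps ℚ^n → ℚ^m as
-- m×n matrices (functional), compared entrywise.

Mat : ℕ → ℕ → Set
Mat m n = Fin m → Fin n → ℚ

sumFin : ∀ n → (Fin n → ℚ) → ℚ
sumFin zero    f = 0ℚ
sumFin (suc n) f = f zero + sumFin n (λ i → f (suc i))

_·_ : ∀ {m n k} → Mat m n → Mat n k → Mat m k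
_·_ {n = n} M N i j = sumFin n (λ l → M i l * N l j)

idMat : ∀ {m} → Mat m m
idMat i j = if ⌊ i ≟ j ⌋ then 1ℚ else 0ℚ

zeroMat : ∀ {m n} → Mat m n
zeroMat _ _ = 0ℚ

_≋_ : ∀ {m n} → Mat m n → Mat m n → Set
M ≋ N = ∀ i j → M i j ≡ N i j

-- Data of an assignment C^op → (f.d. ℚ-vector spaces): an object X goes
-- to ℚ^(dim X), a morphism φ : X → Y goes to a linear map
-- F(Y) → F(X), i.e. a (dim X)×(dim Y) matrix.
record PreFunctor (C : Category) : Set where
  field
    dim : Obj C → ℕ
    act : ∀ {X Y} → Hom C X Y → Mat (dim X) (dim Y)

open PreFunctor public

IsFunctor : (C : Category) → PreFunctor C → Set
IsFunctor C F =
  (∀ {X} → act F (id C {X}) ≋ idMat) ×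
  (∀ {X Y W} (f : Hom C X Y) (g : Hom C Y W) →
     act F (_∘_ C g f) ≋ (act F f · act F g))

QFunctor : Category → Set
QFunctor C = Σ (PreFunctor C) (IsFunctor C)

dimIn : Bool → ℕ → ℕ
dimIn b m = if b then m else 0

extMat : ∀ {m n} (b c : Bool) → Mat m n → Mat (dimIn b m) (dimIn c n)
extMat true  true  M = M
extMat true  false M = zeroMat
extMat false true  M = zeroMat
extMat false false M = zeroMat

ZeroExt : (C : Category) → PreFunctor C → Subset C → PreFunctor C
dim (ZeroExt C F A) X = dimIn (A X) (dim F X)
act (ZeroExt C F A) {X} {Y} φ = extMat (A X) (A Y) (act F φ)

ZeroExtensionsExist : (C : Category) → Subset C → Set
ZeroExtensionsExist C A =
  (F : QFunctor C) → IsFunctor C (ZeroExt C (proj₁ F) A)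

{-# OPTIONS --safe #-}
-- A locally closed set, and likewise a set equal to open(A) ∩ closed(A), has no cavities:
-- a path X → Y → W with X, W ∈ A puts Y in every open set and every closed set containing A.
-- Conversely a cavity-free A is the intersection of the open set of objects with a morphism
-- into A and the closed set of objects with a morphism out of A; finiteness of the category
-- makes both decidable, hence subsets.  The zero extension F_A can only fail to be functorial
-- on a composite X → Y → W with X, W ∈ A and Y ∉ A, where F_A(φ₂ ∘ φ₁) would have to factor
-- through the zero space; cavity-freeness excludes this, and the constant functor ℚ shows
-- that such a factorisation is indeed impossible.
module Submission where

open import Defs
open import Data.Bool using (Bool; true; false)
open import Data.Bool.Properties using (T-≡) renaming (_≟_ to _≟ᵇ_)
open import Data.Fin using (Fin; zero)
open import Data.Fin.Properties using (any?) renaming (_≟_ to _≟ᶠ_)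
open import Data.Nat using (ℕ)
open import Data.Product using (_×_; _,_; proj₁; proj₂; ∃; ∃₂)
open import Level using (0ℓ)
open import Function using (_∘′_)
open import Function.Bundles using (_⇔_; mk⇔; _↔_; mk↣; Inverse; Equivalence)
open import Function.Properties.Inverse using (↔⇒↣; ↔-sym)
open import Relation.Binary.Definitions using (DecidableEquality)
open import Relation.Binary.PropositionalEquality using (_≡_; refl; sym; cong; subst)
open import Relation.Nullary using (Dec; contradiction)
open import Relation.Nullary.Decidable
  using (⌊_⌋; map′; _×-dec_; toWitness; fromWitness; via-injection)
open import Relation.Unary using (Pred; Decidable)

module _ {T : Set} {n : ℕ} (enum : Fin n ↔ T) where
  open Inverse enum

  any?-enumerable : {P : Pred T 0ℓ} → Decidable P → Dec (∃ P)
  any?-enumerable {P} P? =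
    map′ (λ (i , p) → to i , p)
         (λ (t , p) → from t , subst P (sym (strictlyInverseˡ t)) p)
         (any? λ i → P? (to i))

  ≟-enumerable : DecidableEquality T
  ≟-enumerable = via-injection (↔⇒↣ (↔-sym enum)) _≟ᶠ_

extMat-idMat : ∀ {m} (b : Bool) {M : Mat m m} → M ≋ idMat → extMat b b M ≋ idMat
extMat-idMat true  M≋I = M≋I
extMat-idMat false _ ()

extMat-· : ∀ {m n k} (b c d : Bool) {M : Mat m n} {N : Mat n k} {P : Mat m k} →
           (b ≡ true → d ≡ true → c ≡ true) → P ≋ (M · N) →
           extMat b d P ≋ (extMat b c M · extMat c d N)
extMat-· true  true  true  _        P≋MN = P≋MN
extMat-· true  false true  noCavity _    = contradiction (noCavity refl refl) λ ()
extMat-· true  _     false _        _    _ ()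
extMat-· false _     _     _        _    ()

extMat-idMat-·⇒true : ∀ {b c d} → b ≡ true → d ≡ true →
                      extMat {1} {1} b d idMat ≋ (extMat b c idMat · extMat c d idMat) → c ≡ true
extMat-idMat-·⇒true {c = true}  refl refl _ = refl
extMat-idMat-·⇒true {c = false} refl refl 1≋0 = contradiction (1≋0 zero zero) λ ()

module _ (C : Category) where

  fromDecidable : {P : Pred (Obj C) 0ℓ} → Decidable P → Subset C
  fromDecidable P? X = ⌊ P? X ⌋

  ∈-fromDecidable : {P : Pred (Obj C) 0ℓ} (P? : Decidable P) {X : Obj C} →
                    _∈_ {C} X (fromDecidable P?) ⇔ P X
  ∈-fromDecidable P? = mk⇔ (toWitness ∘′ Equivalence.from T-≡)
                           (Equivalence.to T-≡ ∘′ fromWitness)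

  MapsInto : Subset C → Pred (Obj C) 0ℓ
  MapsInto A Y = ∃₂ λ W (φ : Hom C Y W) → A W ≡ true

  MapsFrom : Subset C → Pred (Obj C) 0ℓ
  MapsFrom A Y = ∃₂ λ X (φ : Hom C X Y) → A X ≡ true

  MapsInto-precomp : ∀ {A X Y} → Hom C X Y → MapsInto A Y → MapsInto A X
  MapsInto-precomp φ (W , ψ , w) = W , _∘_ C ψ φ , w

  MapsFrom-postcomp : ∀ {A X Y} → Hom C X Y → MapsFrom A X → MapsFrom A Y
  MapsFrom-postcomp φ (W , ψ , w) = W , _∘_ C φ ψ , w

  locallyClosed⇒cavityFree : ∀ {A} → IsLocallyClosed C A → CavityFree C A
  locallyClosed⇒cavityFree (U , Z , U-open , Z-closed , A≡U∩Z) φ₁ φ₂ x∈A w∈A =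
    proj₂ (A≡U∩Z _) ( U-open φ₂ (proj₁ (proj₁ (A≡U∩Z _) w∈A))
                    , Z-closed φ₁ (proj₂ (proj₁ (A≡U∩Z _) x∈A)))

  locallyClosed⇒equalsHullIntersection :
    ∀ {A} → IsLocallyClosed C A → EqualsHullIntersection C A
  locallyClosed⇒equalsHullIntersection (U , Z , U-open , Z-closed , A≡U∩Z) X =
    (λ x∈A → (λ _ _ A⊆U → A⊆U X x∈A) , (λ _ _ A⊆Z → A⊆Z X x∈A)) ,
    λ (x∈open , x∈closed) →
      proj₂ (A≡U∩Z X) ( x∈open U U-open (λ Y → proj₁ ∘′ proj₁ (A≡U∩Z Y))
                      , x∈closed Z Z-closed (λ Y → proj₂ ∘′ proj₁ (A≡U∩Z Y)))

  equalsHullIntersection⇒cavityFree :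
    ∀ {A} → EqualsHullIntersection C A → CavityFree C A
  equalsHullIntersection⇒cavityFree A≡hulls {X} {Y} {W} φ₁ φ₂ x∈A w∈A =
    proj₂ (A≡hulls Y) ( (λ _ U-open A⊆U → U-open φ₂ (A⊆U W w∈A))
                      , (λ _ Z-closed A⊆Z → Z-closed φ₁ (A⊆Z X x∈A)))

  constantℚ : QFunctor C
  constantℚ = record { dim = λ _ → 1 ; act = λ _ → idMat }
            , (λ { zero zero → refl })
            , (λ { _ _ zero zero → refl })

  cavityFree⇒zeroExtensionsExist : ∀ {A} → CavityFree C A → ZeroExtensionsExist C A
  cavityFree⇒zeroExtensionsExist {A} cavityFree (F , F-id , F-∘) =
    (λ {X} → extMat-idMat (A X) F-id) ,
    (λ {X} {Y} {W} φ₁ φ₂ → extMat-· (A X) (A Y) (A W) (cavityFree φ₁ φ₂) (F-∘ φ₁ φ₂))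

  zeroExtensionsExist⇒cavityFree : ∀ {A} → ZeroExtensionsExist C A → CavityFree C A
  zeroExtensionsExist⇒cavityFree zeroExt φ₁ φ₂ x∈A w∈A =
    extMat-idMat-·⇒true x∈A w∈A (proj₂ (zeroExt constantℚ) φ₁ φ₂)

module FiniteCategory (C : Category) (finite : Finite C) where
  private
    enum = proj₂ finite

  _≟ₒ_ : DecidableEquality (Obj C)
  _≟ₒ_ = via-injection (mk↣ {to = λ X → X , X , id C} (cong proj₁)) (≟-enumerable enum)

  mapsInto? : (A : Subset C) → Decidable (MapsInto C A)
  mapsInto? A Y =
    map′ (λ { ((.Y , W , φ) , refl , w) → W , φ , w })
         (λ (W , φ , w) → (Y , W , φ) , refl , w)
         (any?-enumerable enum λ (X , W , _) → (X ≟ₒ Y) ×-dec (A W ≟ᵇ true))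

  mapsFrom? : (A : Subset C) → Decidable (MapsFrom C A)
  mapsFrom? A Y =
    map′ (λ { ((X , .Y , φ) , w , refl) → X , φ , w })
         (λ (X , φ , w) → (X , Y , φ) , w , refl)
         (any?-enumerable enum λ (X , W , _) → (A X ≟ᵇ true) ×-dec (W ≟ₒ Y))

  cavityFree⇒locallyClosed : ∀ {A} → CavityFree C A → IsLocallyClosed C A
  cavityFree⇒locallyClosed {A} cavityFree =
    U , Z , U-open , Z-closed ,
    λ X → (λ x∈A → ∈U.from (X , id C , x∈A) , ∈Z.from (X , id C , x∈A))
        , λ (x∈U , x∈Z) → let (_ , ψ , w) = ∈U.to x∈U ; (_ , φ , v) = ∈Z.to x∈Z
                          in cavityFree φ ψ v w
    where
    U = fromDecidable C (mapsInto? A)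
    Z = fromDecidable C (mapsFrom? A)
    module ∈U {X} = Equivalence (∈-fromDecidable C (mapsInto? A) {X})
    module ∈Z {X} = Equivalence (∈-fromDecidable C (mapsFrom? A) {X})

    U-open : IsOpen C U
    U-open φ = ∈U.from ∘′ MapsInto-precomp C φ ∘′ ∈U.to

    Z-closed : IsClosed C Z
    Z-closed φ = ∈Z.from ∘′ MapsFrom-postcomp C φ ∘′ ∈Z.to

mainTheorem6 : (C : Category) → Finite C → TopologicalType C → (A : Subset C) →
    (IsLocallyClosed C A ⇔ EqualsHullIntersection C A) ×
    (IsLocallyClosed C A ⇔ CavityFree C A) ×
    (IsLocallyClosed C A ⇔ ZeroExtensionsExist C A)
mainTheorem6 C finite _ A =
  mk⇔ (locallyClosed⇒equalsHullIntersection C)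
      (cavityFree⇒locallyClosed ∘′ equalsHullIntersection⇒cavityFree C) ,
  mk⇔ (locallyClosed⇒cavityFree C) cavityFree⇒locallyClosed ,
  mk⇔ (cavityFree⇒zeroExtensionsExist C ∘′ locallyClosed⇒cavityFree C)
      (cavityFree⇒locallyClosed ∘′ zeroExtensionsExist⇒cavityFree C)
  where open FiniteCategory C finite
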